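{- For any connected graphs $G_1$ and $G_2$, $$pd(G_1\times G_2)\le pd(G_1)+dim(G_2).$$
   Context: All graphs are finite, simple and connected; $d(u,v)$ is the shortest-path distance, and $d(v,P)=\min\{d(v,x):x\in P\}$ for a nonempty vertex set $P$. For an ordered set $S=\{v_1,\dots,v_k\}$ of vertices, $r(v|S)=(d(v,v_1),\dots,d(v,v_k))$; $S$ is a resolving set if $r(u|S)\neq r(v|S)$ for all distinct vertices $u,v$, and the metric dimension $dim(G)$ is the minimum cardinality of a resolving set. For an ordered partition $\Pi=\{P_1,\dots,P_t\}$ of the vertex set, $r(v|\Pi)=(d(v,P_1),\dots,d(v,P_t))$; $\Pi$ is a resolving partition if all these vectors are distinct, and the partition dimension $pd(G)$ is the minimum number of sets in a resolving partition. The Cartesian product $G_1\times G_2$ has vertex set $V_1\times V_2$, with $(a,b)\sim(c,d)$ iff ($a=c$ and $bd\in E_2$) or ($b=d$ and $ac\in E_1$). -}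

module Defs where

open import Data.Nat using (ℕ; zero; suc; _≤_)
open import Data.Fin using (Fin)
open import Data.List using (List; cartesianProduct)
open import Data.List.Membership.Propositional using (_∈_)
open import Data.List.Membership.Propositional.Properties using (∈-cartesianProduct⁺)
open import Data.Product using (Σ; ∃; ∃-syntax; _×_; _,_; proj₁; proj₂)
open import Data.Product.Properties using (≡-dec)
open import Data.Sum using (_⊎_; inj₁; inj₂)
open import Relation.Nullary using (¬_)
open import Relation.Binary.Definitions using (DecidableEquality)
open import Relation.Binary.PropositionalEquality using (_≡_; _≢_)
open import Function.Definitions using (Injective; Surjective)

record Graph : Set₁ where
  field
    V        : Set
    _≟_      : DecidableEquality V
    vertices : List V
    complete : ∀ v → v ∈ vertices
    Adj      : V → V → Set
    sym      : ∀ {u v} → Adj u v → Adj v u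
    irrefl   : ∀ {v} → ¬ Adj v v
open Graph public

data Walk (G : Graph) : V G → V G → ℕ → Set where
  nil  : ∀ {u} → Walk G u u 0
  cons : ∀ {u w v k} → Adj G u w → Walk G w v k → Walk G u v (suc k)

Connected : Graph → Set
Connected G = V G × (∀ u v → ∃[ k ] Walk G u v k)

Dist : (G : Graph) → V G → V G → ℕ → Set
Dist G u v k = Walk G u v k × (∀ j → Walk G u v j → k ≤ j)

DistSet : (G : Graph) → V G → (V G → Set) → ℕ → Set
DistSet G v P k =
  (∃[ x ] (P x × Dist G v x k)) × (∀ x j → P x → Dist G v x j → k ≤ j)

IsResolvingSet : (G : Graph) {k : ℕ} → (Fin k → V G) → Set
IsResolvingSet G {k} S = ∀ u v → u ≢ v →
  ∃[ i ] ∃[ a ] ∃[ b ] (Dist G u (S i) a × Dist G v (S i) b × a ≢ b)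

IsMetricDim : Graph → ℕ → Set
IsMetricDim G d =
  (Σ (Fin d → V G) λ S → Injective _≡_ _≡_ S × IsResolvingSet G S)
  × (∀ m (S : Fin m → V G) → Injective _≡_ _≡_ S → IsResolvingSet G S → d ≤ m)

-- An ordered partition {P_1,...,P_t} is given by the class map c : V → Fin t,
-- P_i = { v | c v ≡ i }; surjectivity of c means all parts are nonempty.
Part : (G : Graph) {t : ℕ} → (V G → Fin t) → Fin t → V G → Set
Part G c i v = c v ≡ i

IsPartition : (G : Graph) {t : ℕ} → (V G → Fin t) → Set
IsPartition G c = Surjective _≡_ _≡_ c

IsResolvingPartition : (G : Graph) {t : ℕ} → (V G → Fin t) → Set
IsResolvingPartition G c = ∀ u v → u ≢ v →
  ∃[ i ] ∃[ a ] ∃[ b ]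
    (DistSet G u (Part G c i) a × DistSet G v (Part G c i) b × a ≢ b)

IsPartitionDim : Graph → ℕ → Set
IsPartitionDim G p =
  (Σ (V G → Fin p) λ c → IsPartition G c × IsResolvingPartition G c)
  × (∀ m (c : V G → Fin m) → IsPartition G c → IsResolvingPartition G c → p ≤ m)

CartAdj : (G₁ G₂ : Graph) → V G₁ × V G₂ → V G₁ × V G₂ → Set
CartAdj G₁ G₂ (a , b) (c , d) =
  (a ≡ c × Adj G₂ b d) ⊎ (b ≡ d × Adj G₁ a c)

_□_ : Graph → Graph → Graph
G₁ □ G₂ = record
  { V        = V G₁ × V G₂
  ; _≟_      = ≡-dec (_≟_ G₁) (_≟_ G₂)
  ; vertices = cartesianProduct (vertices G₁) (vertices G₂)
  ; complete = λ { (a , b) → ∈-cartesianProduct⁺ (complete G₁ a) (complete G₂ b) }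
  ; Adj      = CartAdj G₁ G₂
  ; sym      = λ { (inj₁ (e , x)) → inj₁ (Relation.Binary.PropositionalEquality.sym e , Graph.sym G₂ x)
                 ; (inj₂ (e , x)) → inj₂ (Relation.Binary.PropositionalEquality.sym e , Graph.sym G₁ x) }
  ; irrefl   = λ { (inj₁ (_ , x)) → irrefl G₂ x ; (inj₂ (_ , x)) → irrefl G₁ x }
  }

-- Let c₁ be a resolving partition of G₁ into p classes and S a metric basis of G₂
-- with d landmarks.  Partition G₁ × G₂ into the d "landmark fibres" V₁ × {S j}
-- and the p sets P_i × (V₂ ∖ S), where P_i are the classes of c₁.  Two vertices in different G₂-fibres are told
-- apart by a landmark fibre, since d((x,y), V₁ × {S j}) = d(y, S j); two vertices
-- in the same G₂-fibre y are told apart by some P_i × (V₂ ∖ S), since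
-- d((x,y), P_i × (V₂ ∖ S)) = d(x, P_i) + d(y, V₂ ∖ S).  The classes P_i × (V₂ ∖ S)
-- are nonempty because a metric basis never contains every vertex: dropping one
-- vertex from V₂ still leaves a resolving set.
--
-- Adjacency is not decidable here, so distances exist only under double
-- negation; the conclusion q ≤ p + d is decidable, which lets us work in the
-- double-negation monad throughout.
module Submission where

open import Defs hiding (sym)
open import Data.Nat using (ℕ; zero; suc; _≤_; _<_; _+_; _≤?_; z≤n)
open import Data.Nat.Properties using (≤-trans; 1+n≰n; ≮⇒≥; +-cancelʳ-≡; +-mono-≤; +-suc)
open import Data.Nat.Induction using (<-rec)
open import Data.Fin using (Fin; splitAt; join) renaming (zero to fzero; suc to fsuc)
open import Data.Fin.Properties using (any?; splitAt-join; join-splitAt; suc-injective)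
open import Data.List using (List; []; _∷_)
open import Data.List.Membership.Propositional using (_∈_)
open import Data.List.Relation.Unary.Any using (here; there)
open import Data.Product using (∃; ∃-syntax; ∃₂; _×_; _,_; proj₁; proj₂)
open import Data.Sum using (_⊎_; inj₁; inj₂)
open import Data.Unit using (⊤; tt)
open import Data.Empty using (⊥-elim)
open import Effect.Monad using (RawMonad)
open import Function using (_∘_; _⇔_; mk⇔; Equivalence)
open import Function.Definitions using (Injective)
open import Level using (0ℓ)
open import Relation.Nullary using (¬_; Dec; yes; no)
open import Relation.Nullary.Decidable using (decidable-stable; ¬¬-excluded-middle)
open import Relation.Nullary.Negation using (¬¬-Monad)
open import Relation.Unary using (Decidable)
open import Relation.Binary.PropositionalEquality using (_≡_; _≢_; refl; sym; trans; cong; ≢-sym)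

open RawMonad (¬¬-Monad {a = 0ℓ})

Least : (ℕ → Set) → Set
Least Q = ∃[ n ] (Q n × ∀ m → m < n → ¬ Q m)

least-≤ : ∀ {Q : ℕ → Set} {n j} → (∀ m → m < n → ¬ Q m) → Q j → n ≤ j
least-≤ none qj = ≮⇒≥ (λ j<n → none _ j<n qj)

¬¬-least : (Q : ℕ → Set) → ∀ k → Q k → ¬ ¬ Least Q
¬¬-least Q = <-rec {ℓ = 0ℓ} (λ k → Q k → ¬ ¬ Least Q) λ k below qk →
  ¬¬-excluded-middle {A = ∃[ m ] (m < k × Q m)} >>= λ where
    (yes (m , m<k , qm)) → below m<k qm
    (no none)            → pure (k , qk , λ m m<k qm → none (m , m<k , qm))

module _ {G : Graph} where

  _++ʷ_ : ∀ {u w v m n} → Walk G u w m → Walk G w v n → Walk G u v (m + n)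
  nil      ++ʷ w′ = w′
  cons e w ++ʷ w′ = cons e (w ++ʷ w′)

  ¬¬-∀∈ : {R : V G → Set} → (∀ v → ¬ ¬ R v) → (L : List (V G)) → ¬ ¬ (∀ v → v ∈ L → R v)
  ¬¬-∀∈ f []      = pure λ _ ()
  ¬¬-∀∈ f (u ∷ L) = do
    ru ← f u
    rL ← ¬¬-∀∈ f L
    pure λ { v (here refl) → ru ; v (there v∈L) → rL v v∈L }

  ¬¬-∀ : {R : V G → Set} → (∀ v → ¬ ¬ R v) → ¬ ¬ (∀ v → R v)
  ¬¬-∀ f = do
    all∈ ← ¬¬-∀∈ f (vertices G)
    pure λ v → all∈ v (complete G v)

  dist-refl : ∀ {u} → Dist G u u 0
  dist-refl = nil , λ _ _ → z≤n

  dist-zero⇒≡ : ∀ {u v} → Dist G u v 0 → u ≡ v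
  dist-zero⇒≡ (nil , _) = refl

  ≢⇒dist≢0 : ∀ {u v k} → u ≢ v → Dist G u v k → k ≢ 0
  ≢⇒dist≢0 u≢v duv refl = u≢v (dist-zero⇒≡ duv)

  dist-exists : ∀ {u v k} → Walk G u v k → ¬ ¬ ∃ (Dist G u v)
  dist-exists w = do
    n , wn , none ← ¬¬-least (Walk G _ _) _ w
    pure (n , wn , λ j wj → least-≤ none wj)

  distSet-exists : ∀ {v z k} {P : V G → Set} → P z → Walk G v z k → ¬ ¬ ∃ (DistSet G v P)
  distSet-exists {v} {P = P} pz w = do
    n , (x , px , wx) , none ← ¬¬-least (λ n → ∃[ x ] (P x × Walk G v x n)) _ (_ , pz , w)
    pure (n , (x , px , wx , λ j wj → least-≤ none (x , px , wj))
            , λ y j py dy → least-≤ none (y , py , proj₁ dy))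

  distSet≤walk : ∀ {v z a k} {P : V G → Set} → DistSet G v P a → P z → Walk G v z k → a ≤ k
  distSet≤walk {a = a} {k} (_ , nearest) pz w = decidable-stable (a ≤? k) do
    e , de ← dist-exists w
    pure (≤-trans (nearest _ e pz de) (proj₂ de k w))

  dist⇒distSet : ∀ {u v a} → Dist G u v a → DistSet G u (_≡ v) a
  dist⇒distSet duv@(_ , shortest) = (_ , refl , duv) , λ { _ j refl (w , _) → shortest j w }

  distSet-univ : ∀ {v} → DistSet G v (λ _ → ⊤) 0
  distSet-univ = (_ , tt , dist-refl) , λ _ _ _ _ → z≤n

  distSet-resp : ∀ {v a} {P Q : V G → Set} → (∀ {x} → P x ⇔ Q x) → DistSet G v P a → DistSet G v Q a
  distSet-resp P⇔Q ((x , px , dx) , nearest) =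
    (x , Equivalence.to P⇔Q px , dx) , λ y j qy → nearest y j (Equivalence.from P⇔Q qy)

  ¬¬-distances : Connected G → ¬ ¬ (∀ u v → ∃ (Dist G u v))
  ¬¬-distances (_ , conn) = ¬¬-∀ λ u → ¬¬-∀ λ v → dist-exists (proj₂ (conn u v))

  -- A vertex S (suc i) is told apart from any other vertex by itself, at distance 0.
  all-but-one-resolving : (∀ u v → ∃ (Dist G u v)) → ∀ {d} (S : Fin (suc d) → V G) →
    (∀ y → ∃ λ j → S j ≡ y) → IsResolvingSet G (S ∘ fsuc)
  all-but-one-resolving D S onto u v u≢v with onto u | onto v
  ... | fsuc i , refl | _ =
    let k , dvu = D v u in i , 0 , k , dist-refl , dvu , ≢-sym (≢⇒dist≢0 (≢-sym u≢v) dvu)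
  ... | fzero , refl | fsuc i , refl =
    let k , duv = D u v in i , k , 0 , duv , dist-refl , ≢⇒dist≢0 u≢v duv
  ... | fzero , refl | fzero , refl = ⊥-elim (u≢v refl)

  metricBasis-not-surjective : Connected G → ∀ {d} (S : Fin d → V G) → Injective _≡_ _≡_ S →
    (∀ m (S′ : Fin m → V G) → Injective _≡_ _≡_ S′ → IsResolvingSet G S′ → d ≤ m) →
    ¬ (∀ y → ∃ λ j → S j ≡ y)
  metricBasis-not-surjective (v₀ , _) {zero} S _ _ onto with onto v₀
  ... | () , _
  metricBasis-not-surjective conn {suc d} S S-inj S-min onto = ¬¬-distances conn λ D →
    1+n≰n (S-min d (S ∘ fsuc) (suc-injective ∘ S-inj) (all-but-one-resolving D S onto))

module _ {G₁ G₂ : Graph} where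

  walk-□ˡ : ∀ {x z y m} → Walk G₁ x z m → Walk (G₁ □ G₂) (x , y) (z , y) m
  walk-□ˡ nil        = nil
  walk-□ˡ (cons e w) = cons (inj₂ (refl , e)) (walk-□ˡ w)

  walk-□ʳ : ∀ {x y t m} → Walk G₂ y t m → Walk (G₁ □ G₂) (x , y) (x , t) m
  walk-□ʳ nil        = nil
  walk-□ʳ (cons e w) = cons (inj₁ (refl , e)) (walk-□ʳ w)

  walk-□ : ∀ {x z y t m n} → Walk G₁ x z m → Walk G₂ y t n → Walk (G₁ □ G₂) (x , y) (z , t) (m + n)
  walk-□ w₁ w₂ = walk-□ˡ w₁ ++ʷ walk-□ʳ w₂

  walk-□-split : ∀ {x y z t m} → Walk (G₁ □ G₂) (x , y) (z , t) m →
    ∃₂ λ m₁ m₂ → Walk G₁ x z m₁ × Walk G₂ y t m₂ × m₁ + m₂ ≡ m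
  walk-□-split nil = 0 , 0 , nil , nil , refl
  walk-□-split (cons (inj₁ (refl , e)) w) with walk-□-split w
  ... | m₁ , m₂ , w₁ , w₂ , eq = m₁ , suc m₂ , w₁ , cons e w₂ , trans (+-suc m₁ m₂) (cong suc eq)
  walk-□-split (cons (inj₂ (refl , e)) w) with walk-□-split w
  ... | m₁ , m₂ , w₁ , w₂ , eq = suc m₁ , m₂ , cons e w₁ , w₂ , cong suc eq

  distSet-□ : ∀ {x y a b} {A : V G₁ → Set} {B : V G₂ → Set} →
    DistSet G₁ x A a → DistSet G₂ y B b →
    DistSet (G₁ □ G₂) (x , y) (λ v → A (proj₁ v) × B (proj₂ v)) (a + b)
  distSet-□ {a = a} {b} {A} {B} dA@((z , az , wz , _) , _) dB@((t , bt , wt , _) , _) =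
    ((z , t) , (az , bt) , walk-□ wz wt , λ _ → bound az bt)
    , λ { (z′ , t′) _ (az′ , bt′) (w , _) → bound az′ bt′ w }
    where
    bound : ∀ {z′ t′ m} → A z′ → B t′ → Walk (G₁ □ G₂) _ (z′ , t′) m → a + b ≤ m
    bound az′ bt′ w with walk-□-split w
    ... | _ , _ , w₁ , w₂ , refl = +-mono-≤ (distSet≤walk dA az′ w₁) (distSet≤walk dB bt′ w₂)

join-injective : ∀ m n {i j : Fin m ⊎ Fin n} → join m n i ≡ join m n j → i ≡ j
join-injective m n {i} {j} eq =
  trans (sym (splitAt-join m n i)) (trans (cong (splitAt m) eq) (splitAt-join m n j))

-- Class join (inj₂ j) is the landmark fibre V₁ × {S j}; class join (inj₁ i)
-- is c₁⁻¹(i) × (V₂ ∖ S).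
module LandmarkPartition {G₁ G₂ : Graph} {p d : ℕ} (c₁ : V G₁ → Fin p)
  (S : Fin d → V G₂) (S-injective : Injective _≡_ _≡_ S) where

  Landmark : V G₂ → Set
  Landmark y = ∃ λ j → S j ≡ y

  landmark? : Decidable Landmark
  landmark? y = any? λ j → _≟_ G₂ (S j) y

  class : V G₁ → (y : V G₂) → Dec (Landmark y) → Fin p ⊎ Fin d
  class x y (yes (j , _)) = inj₂ j
  class x y (no _)        = inj₁ (c₁ x)

  c : V (G₁ □ G₂) → Fin (p + d)
  c (x , y) = join p d (class x y (landmark? y))

  c-landmark : ∀ z j → c (z , S j) ≡ join p d (inj₂ j)
  c-landmark z j with landmark? (S j)
  ... | yes (j′ , e) = cong (join p d ∘ inj₂) (S-injective e)
  ... | no ¬l        = ⊥-elim (¬l (j , refl))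

  c-nonLandmark : ∀ z t → ¬ Landmark t → c (z , t) ≡ join p d (inj₁ (c₁ z))
  c-nonLandmark z t ¬l with landmark? t
  ... | yes l = ⊥-elim (¬l l)
  ... | no _  = refl

  fibre⇔landmarkClass : ∀ {z t j} → (⊤ × t ≡ S j) ⇔ c (z , t) ≡ join p d (inj₂ j)
  fibre⇔landmarkClass {z} {t} {j} = mk⇔ (λ { (_ , refl) → c-landmark z j }) to
    where
    to : c (z , t) ≡ join p d (inj₂ j) → ⊤ × t ≡ S j
    to eq with landmark? t | join-injective p d {class z t (landmark? t)} {inj₂ j} eq
    ... | yes (j′ , refl) | refl = tt , refl

  box⇔nonLandmarkClass : ∀ {z t i} → (c₁ z ≡ i × ¬ Landmark t) ⇔ c (z , t) ≡ join p d (inj₁ i)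
  box⇔nonLandmarkClass {z} {t} {i} = mk⇔ (λ { (refl , ¬l) → c-nonLandmark z t ¬l }) to
    where
    to : c (z , t) ≡ join p d (inj₁ i) → c₁ z ≡ i × ¬ Landmark t
    to eq with landmark? t | join-injective p d {class z t (landmark? t)} {inj₁ i} eq
    ... | no ¬l | refl = refl , ¬l

  c-surjective : V G₁ → ∀ t₀ → ¬ Landmark t₀ → IsPartition G₁ c₁ → IsPartition (G₁ □ G₂) c
  c-surjective x₀ t₀ ¬l c₁-surj k with splitAt p k | join-splitAt p d k
  ... | inj₁ i | refl with c₁-surj i
  ...   | x , c₁x≡i = (x , t₀) , λ { refl →
            trans (c-nonLandmark x t₀ ¬l) (cong (join p d ∘ inj₁) (c₁x≡i refl)) }
  c-surjective x₀ t₀ ¬l c₁-surj k | inj₂ j | refl = (x₀ , S j) , λ { refl → c-landmark x₀ j }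

  distSet-landmarkClass : ∀ {x y j a} → Dist G₂ y (S j) a →
    DistSet (G₁ □ G₂) (x , y) (Part (G₁ □ G₂) c (join p d (inj₂ j))) a
  distSet-landmarkClass dist =
    distSet-resp fibre⇔landmarkClass (distSet-□ distSet-univ (dist⇒distSet dist))

  distSet-nonLandmarkClass : ∀ {x y i a e} → DistSet G₁ x (Part G₁ c₁ i) a →
    DistSet G₂ y (¬_ ∘ Landmark) e →
    DistSet (G₁ □ G₂) (x , y) (Part (G₁ □ G₂) c (join p d (inj₁ i))) (a + e)
  distSet-nonLandmarkClass dx de = distSet-resp box⇔nonLandmarkClass (distSet-□ dx de)

  c-resolving : IsResolvingPartition G₁ c₁ → IsResolvingSet G₂ S →
    (∀ y → ∃ (DistSet G₂ y (¬_ ∘ Landmark))) → IsResolvingPartition (G₁ □ G₂) c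
  c-resolving c₁-res S-res nonLandmarkDist (x , y) (x′ , y′) xy≢x′y′ with _≟_ G₂ y y′
  ... | no y≢y′ =
    let j , a , b , da , db , a≢b = S-res y y′ y≢y′
    in join p d (inj₂ j) , a , b , distSet-landmarkClass da , distSet-landmarkClass db , a≢b
  ... | yes refl =
    let i , a , b , da , db , a≢b = c₁-res x x′ (xy≢x′y′ ∘ cong (_, y))
        e , de = nonLandmarkDist y
    in join p d (inj₁ i) , a + e , b + e ,
       distSet-nonLandmarkClass da de , distSet-nonLandmarkClass db de , a≢b ∘ +-cancelʳ-≡ e a b

theorem2 : (G₁ G₂ : Graph) → Connected G₁ → Connected G₂ →
    ∀ (p d q : ℕ) → IsPartitionDim G₁ p → IsMetricDim G₂ d →
    IsPartitionDim (G₁ □ G₂) q → q ≤ p + d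
theorem2 G₁ G₂ (x₀ , _) conn₂ p d q ((c₁ , c₁-surj , c₁-res) , _) ((S , S-inj , S-res) , S-min) (_ , q-min) =
  decidable-stable (q ≤? p + d) do
    t₀ , ¬l ← nonLandmark-exists
    nonLandmarkDist ← ¬¬-∀ {G₂} λ y → distSet-exists ¬l (proj₂ (proj₂ conn₂ y t₀))
    pure (q-min (p + d) c (c-surjective x₀ t₀ ¬l c₁-surj) (c-resolving c₁-res S-res nonLandmarkDist))
  where
  open LandmarkPartition {G₁} {G₂} c₁ S S-inj

  nonLandmark-exists : ¬ ¬ ∃ (¬_ ∘ Landmark)
  nonLandmark-exists none = metricBasis-not-surjective conn₂ S S-inj S-min λ y →
    decidable-stable (landmark? y) (λ ¬l → none (y , ¬l))
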